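{- The set $\mathbb{N}$ is not a minimal additive complement to any set $W \subseteq \mathbb{Z}$.
   Context: $\mathbb{N}$ denotes the natural numbers (the nonnegative integers). For $C, W \subseteq \mathbb{Z}$, $C + W = \{c + w : c \in C, w \in W\}$. $C$ is an additive complement to $W$ if $C + W = \mathbb{Z}$; it is a minimal additive complement to $W$ if moreover no proper subset of $C$ is an additive complement to $W$. -}

module Defs where

open import Data.Nat using (ℕ)
open import Data.Integer using (ℤ; +_; _+_)
open import Data.Product using (Σ; ∃; _×_)
open import Relation.Binary.PropositionalEquality using (_≡_)
open import Relation.Nullary using (¬_)

SubsetZ : Set₁
SubsetZ = ℤ → Set

_⊆Z_ : SubsetZ → SubsetZ → Set
C ⊆Z D = ∀ z → C z → D z

_⊂Z_ : SubsetZ → SubsetZ → Set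
C' ⊂Z C = (C' ⊆Z C) × ∃ λ x → C x × ¬ C' x

IsAdditiveComplement : SubsetZ → SubsetZ → Set
IsAdditiveComplement C W =
  ∀ (z : ℤ) → ∃ λ c → ∃ λ w → C c × W w × z ≡ c + w

IsMinimalAdditiveComplement : SubsetZ → SubsetZ → Set₁
IsMinimalAdditiveComplement C W =
  IsAdditiveComplement C W ×
  (∀ (C' : SubsetZ) → C' ⊂Z C → ¬ IsAdditiveComplement C' W)

ℕset : SubsetZ
ℕset z = ∃ λ (n : ℕ) → z ≡ + n

{-# OPTIONS --safe #-}
module Submission where

-- Any translate C + t of a complement C to W is again a complement, as (C + t) + W = ℤ + t.
-- The translate ℕ + 1 is a proper subset of ℕ, so ℕ is never minimal.

open import Defs
open import Data.Nat using (suc)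
open import Data.Integer using (ℤ; +_; _+_; _-_)
open import Data.Integer.Properties using (+-assoc; +-comm; +-0-abelianGroup)
open import Algebra.Bundles using (AbelianGroup)
open import Algebra.Properties.Group (AbelianGroup.group +-0-abelianGroup) using (//-rightDividesˡ)
open import Data.Product using (∃; _×_; _,_)
open import Relation.Binary.PropositionalEquality using (_≡_; refl; sym; cong; module ≡-Reasoning)
open import Relation.Nullary using (¬_)

translate : ℤ → SubsetZ → SubsetZ
translate t C z = ∃ λ c → C c × z ≡ t + c

positives : SubsetZ
positives = translate (+ 1) ℕset

translate-complement : ∀ {C W} t → IsAdditiveComplement C W → IsAdditiveComplement (translate t C) W
translate-complement t complement z with complement (z - t)
... | c , w , c∈C , w∈W , z-t≡c+w = t + c , w , (c , c∈C , refl) , w∈W , z≡t+c+w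
  where
  open ≡-Reasoning
  z≡t+c+w : z ≡ t + c + w
  z≡t+c+w = begin
    z           ≡⟨ sym (//-rightDividesˡ t z) ⟩
    z - t + t   ≡⟨ +-comm (z - t) t ⟩
    t + (z - t) ≡⟨ cong (_+_ t) z-t≡c+w ⟩
    t + (c + w) ≡⟨ sym (+-assoc t c w) ⟩
    t + c + w   ∎

positives⊂ℕ : positives ⊂Z ℕset
positives⊂ℕ = positives⊆ℕ , + 0 , (0 , refl) , 0∉positives
  where
  positives⊆ℕ : positives ⊆Z ℕset
  positives⊆ℕ _ (_ , (n , refl) , refl) = suc n , refl

  0∉positives : ¬ positives (+ 0)
  0∉positives (_ , (n , refl) , ())

proposition2 : (W : SubsetZ) → ¬ IsMinimalAdditiveComplement ℕset W
proposition2 W (complement , minimal) =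
  minimal positives positives⊂ℕ (translate-complement (+ 1) complement)
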